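{- For every $H^{\vee,\triangle}_3$-algebra $A$, the poset of congruences of $A$ is lattice-isomorphic to the poset of modal deductive systems of $A$.
   Context: An $H^{\vee,\triangle}_3$-algebra is an algebra $(A,\to,\vee,\triangle,1)$ such that: $(A,\vee,1)$ is a join-semilattice with top $1$; $x\to(x\vee y)=1$ and $(x\to y)\to((x\vee y)\to y)=1$; whenever the infimum $x\wedge y$ exists, $\triangle(x\wedge y)=\triangle x\wedge\triangle y$; $(A,\to,1)$ satisfies $x\to(y\to x)=1$, $(x\to(y\to z))\to((x\to y)\to(x\to z))=1$, ($x\to y=1=y\to x$ implies $x=y$), and $((x\to y)\to z)\to(((z\to x)\to z)\to z)=1$; and $\triangle x\to x=1$, $((y\to\triangle y)\to(x\to\triangle\triangle x))\to\triangle(x\to y)=\triangle x\to\triangle\triangle y$, $(\triangle x\to\triangle y)\to\triangle x=\triangle x$. A modal deductive system is $D\subseteq A$ with $1\in D$; $x,x\to y\in D$ implies $y\in D$; $x\in D$ implies $\triangle x\in D$. Both posets are ordered by inclusion. -}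

module Defs where

open import Level using (Level; _⊔_; suc)
open import Data.Product using (Σ; _×_; _,_)
open import Relation.Binary.PropositionalEquality using (_≡_)
open import Relation.Binary.Core using (Rel)
open import Relation.Binary.Structures using (IsEquivalence)
open import Relation.Unary using (Pred; _∈_)

record H∨△₃ (a : Level) : Set (suc a) where
  infixr 5 _⇒_
  infixl 6 _∨_
  field
    Carrier : Set a
    _⇒_     : Carrier → Carrier → Carrier
    _∨_     : Carrier → Carrier → Carrier
    △       : Carrier → Carrier
    𝟏       : Carrier

  _≤_ : Carrier → Carrier → Set a
  x ≤ y = (x ∨ y) ≡ y

  IsInf : Carrier → Carrier → Carrier → Set a
  IsInf x y z = (z ≤ x) × (z ≤ y) × (∀ w → w ≤ x → w ≤ y → w ≤ z)

  field
    ∨-assoc : ∀ x y z → ((x ∨ y) ∨ z) ≡ (x ∨ (y ∨ z))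
    ∨-comm  : ∀ x y → (x ∨ y) ≡ (y ∨ x)
    ∨-idem  : ∀ x → (x ∨ x) ≡ x
    ∨-top   : ∀ x → (x ∨ 𝟏) ≡ 𝟏
    ax-∨₁ : ∀ x y → (x ⇒ (x ∨ y)) ≡ 𝟏
    ax-∨₂ : ∀ x y → ((x ⇒ y) ⇒ ((x ∨ y) ⇒ y)) ≡ 𝟏
    ax-△∧ : ∀ x y z → IsInf x y z → IsInf (△ x) (△ y) (△ z)
    ax-K : ∀ x y → (x ⇒ (y ⇒ x)) ≡ 𝟏
    ax-S : ∀ x y z → ((x ⇒ (y ⇒ z)) ⇒ ((x ⇒ y) ⇒ (x ⇒ z))) ≡ 𝟏
    ax-antisym : ∀ x y → (x ⇒ y) ≡ 𝟏 → (y ⇒ x) ≡ 𝟏 → x ≡ y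
    ax-H₃ : ∀ x y z → (((x ⇒ y) ⇒ z) ⇒ (((z ⇒ x) ⇒ z) ⇒ z)) ≡ 𝟏
    ax-△₁ : ∀ x → (△ x ⇒ x) ≡ 𝟏
    ax-△₂ : ∀ x y → (((y ⇒ △ y) ⇒ (x ⇒ △ (△ x))) ⇒ △ (x ⇒ y)) ≡ (△ x ⇒ △ (△ y))
    ax-△₃ : ∀ x y → ((△ x ⇒ △ y) ⇒ △ x) ≡ △ x

module _ {a : Level} (A : H∨△₃ a) where
  open H∨△₃ A

  record IsCongruence {ℓ : Level} (θ : Rel Carrier ℓ) : Set (a ⊔ ℓ) where
    field
      isEquivalence : IsEquivalence θ
      ⇒-compat : ∀ {x x' y y'} → θ x x' → θ y y' → θ (x ⇒ y) (x' ⇒ y')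
      ∨-compat : ∀ {x x' y y'} → θ x x' → θ y y' → θ (x ∨ y) (x' ∨ y')
      △-compat : ∀ {x x'} → θ x x' → θ (△ x) (△ x')

  record IsModalDS {ℓ : Level} (D : Pred Carrier ℓ) : Set (a ⊔ ℓ) where
    field
      one-∈ : 𝟏 ∈ D
      mp    : ∀ {x y} → x ∈ D → (x ⇒ y) ∈ D → y ∈ D
      △-∈   : ∀ {x} → x ∈ D → △ x ∈ D

  Con : (ℓ : Level) → Set (a ⊔ suc ℓ)
  Con ℓ = Σ (Rel Carrier ℓ) IsCongruence

  MDS : (ℓ : Level) → Set (a ⊔ suc ℓ)
  MDS ℓ = Σ (Pred Carrier ℓ) IsModalDS

  _⊆Con_ : ∀ {ℓ} → Con ℓ → Con ℓ → Set (a ⊔ ℓ)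
  (θ , _) ⊆Con (ψ , _) = ∀ {x y} → θ x y → ψ x y

  _⊆MDS_ : ∀ {ℓ} → MDS ℓ → MDS ℓ → Set (a ⊔ ℓ)
  (D , _) ⊆MDS (E , _) = ∀ {x} → x ∈ D → x ∈ E

-- An order isomorphism between preorders (P, ≤P) and (Q, ≤Q), where equality
-- of elements is taken to be mutual inclusion (no function extensionality).
-- An order isomorphism between lattices is a lattice isomorphism.
record OrderIso {p q r s : Level} (P : Set p) (Q : Set q)
                (_≤P_ : P → P → Set r) (_≤Q_ : Q → Q → Set s)
                : Set (p ⊔ q ⊔ r ⊔ s) where
  field
    to        : P → Q
    from      : Q → P
    to-mono   : ∀ {x y} → x ≤P y → to x ≤Q to y
    from-mono : ∀ {x y} → x ≤Q y → from x ≤P from y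
    from∘to₁  : ∀ x → from (to x) ≤P x
    from∘to₂  : ∀ x → x ≤P from (to x)
    to∘from₁  : ∀ y → to (from y) ≤Q y
    to∘from₂  : ∀ y → y ≤Q to (from y)

{-# OPTIONS --safe #-}
module Submission where

open import Level using (Level)
open import Data.List using (List; []; _∷_)
open import Data.List.Membership.Propositional using () renaming (_∈_ to _∈ˡ_)
open import Data.List.Relation.Unary.Any using (here; there)
open import Data.Product using (_×_; _,_)
open import Relation.Binary.Core using (Rel)
open import Relation.Binary.Structures using (IsEquivalence)
open import Relation.Binary.PropositionalEquality
  using (_≡_; refl; sym; trans; cong; cong₂; subst; module ≡-Reasoning)
open import Relation.Unary using (Pred; _∈_)
open import Defs

-- A congruence θ corresponds to the class of 𝟏, and a modal deductive system D
-- to the relation "x ⇒ y and y ⇒ x lie in D".  Compatibility of that relation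
-- with ⇒, ∨ and △ comes from monotonicity laws valid in A, the last one being
-- △(x ⇒ y) ≤ △x ⇒ △y.  A congruence is recovered from its class of 𝟏 because
-- (x ⇒ y) ⇒ ((y ⇒ x) ⇒ x) is symmetric in x and y: modulo θ it equals x when
-- x ⇒ y and y ⇒ x are θ-related to 𝟏.

pattern 1st = here refl
pattern 2nd = there 1st
pattern 3rd = there 2nd
pattern 4th = there 3rd

module _ {a : Level} (A : H∨△₃ a) where
  open H∨△₃ A

  infix 4 _≼_ _⊢_
  infixr 5 _⇒⋆_

  _≼_ : Carrier → Carrier → Set a
  x ≼ y = (x ⇒ y) ≡ 𝟏

  ≼-top : ∀ x → x ≼ 𝟏
  ≼-top x = subst (x ≼_) (∨-top x) (ax-∨₁ x 𝟏)

  modus-ponens : ∀ {x y} → x ≡ 𝟏 → x ≼ y → y ≡ 𝟏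
  modus-ponens {y = y} refl 𝟏≼y = ax-antisym y 𝟏 (≼-top y) 𝟏≼y

  ≼-const : ∀ {x} y → x ≡ 𝟏 → y ≼ x
  ≼-const {x} y x≡𝟏 = modus-ponens x≡𝟏 (ax-K x y)

  ≼-S : ∀ {x y z} → x ≼ (y ⇒ z) → x ≼ y → x ≼ z
  ≼-S {x} {y} {z} x≼y⇒z x≼y = modus-ponens x≼y (modus-ponens x≼y⇒z (ax-S x y z))

  ≼-refl : ∀ x → x ≼ x
  ≼-refl x = ≼-S (ax-K x (x ⇒ x)) (ax-K x x)

  ≼-trans : ∀ {x y z} → x ≼ y → y ≼ z → x ≼ z
  ≼-trans {x} x≼y y≼z = ≼-S (≼-const x y≼z) x≼y

  ⇒-identityˡ : ∀ x → (𝟏 ⇒ x) ≡ x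
  ⇒-identityˡ x = ax-antisym (𝟏 ⇒ x) x (≼-S (≼-refl (𝟏 ⇒ x)) (≼-top (𝟏 ⇒ x))) (ax-K x 𝟏)

  ≼-weakenʳ : ∀ {x y z} → x ≼ z → x ≼ (y ⇒ z)
  ≼-weakenʳ {x} {y} {z} x≼z = ≼-S (≼-const x (ax-K z y)) x≼z

  _⇒⋆_ : List Carrier → Carrier → Carrier
  [] ⇒⋆ z = z
  (c ∷ Γ) ⇒⋆ z = c ⇒ Γ ⇒⋆ z

  -- A record rather than a synonym, so that Γ can be inferred from Γ ⊢ z.
  record _⊢_ (Γ : List Carrier) (z : Carrier) : Set a where
    constructor derivation
    field valid : Γ ⇒⋆ z ≡ 𝟏
  open _⊢_

  ⊢-const : ∀ {Γ z} → z ≡ 𝟏 → Γ ⊢ z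
  ⊢-const {[]} z≡𝟏 = derivation z≡𝟏
  ⊢-const {c ∷ Γ} z≡𝟏 = derivation (≼-const c (valid (⊢-const {Γ} z≡𝟏)))

  ⇒⋆-distrib : ∀ Γ x y → (Γ ⇒⋆ (x ⇒ y)) ≼ ((Γ ⇒⋆ x) ⇒ (Γ ⇒⋆ y))
  ⇒⋆-distrib [] x y = ≼-refl (x ⇒ y)
  ⇒⋆-distrib (c ∷ Γ) x y =
    ≼-trans (modus-ponens (≼-const c (⇒⋆-distrib Γ x y)) (ax-S c _ _)) (ax-S c _ _)

  ⊢-mp : ∀ {Γ x y} → Γ ⊢ x → Γ ⊢ x ⇒ y → Γ ⊢ y
  ⊢-mp {Γ} {x} {y} ⊢x ⊢x⇒y =
    derivation (modus-ponens (valid ⊢x) (modus-ponens (valid ⊢x⇒y) (⇒⋆-distrib Γ x y)))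

  ⊢-≼ : ∀ {Γ x y} → Γ ⊢ x → x ≼ y → Γ ⊢ y
  ⊢-≼ ⊢x x≼y = ⊢-mp ⊢x (⊢-const x≼y)

  ⊢-hyp : ∀ {Γ c} → c ∈ˡ Γ → Γ ⊢ c
  ⊢-hyp {c ∷ Γ} 1st = derivation (head Γ)
    where
      head : ∀ Δ → (c ∷ Δ) ⇒⋆ c ≡ 𝟏
      head [] = ≼-refl c
      head (d ∷ Δ) = ≼-weakenʳ (head Δ)
  ⊢-hyp {d ∷ Γ} (there c∈Γ) = derivation (≼-const d (valid (⊢-hyp c∈Γ)))

  ⇒-trans-≼ : ∀ x y z → (x ⇒ y) ≼ ((y ⇒ z) ⇒ (x ⇒ z))
  ⇒-trans-≼ x y z = valid ⊢z
    where
      ⊢z : (x ⇒ y) ∷ (y ⇒ z) ∷ x ∷ [] ⊢ z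
      ⊢z = ⊢-mp (⊢-mp (⊢-hyp 3rd) (⊢-hyp 1st)) (⊢-hyp 2nd)

  ⇒-mono-≼ : ∀ x x' y y' → (x' ⇒ x) ≼ ((y ⇒ y') ⇒ ((x ⇒ y) ⇒ (x' ⇒ y')))
  ⇒-mono-≼ x x' y y' = valid ⊢y'
    where
      ⊢y' : (x' ⇒ x) ∷ (y ⇒ y') ∷ (x ⇒ y) ∷ x' ∷ [] ⊢ y'
      ⊢y' = ⊢-mp (⊢-mp (⊢-mp (⊢-hyp 4th) (⊢-hyp 1st)) (⊢-hyp 3rd)) (⊢-hyp 2nd)

  ⇒-mutual-comm : ∀ x y → ((x ⇒ y) ⇒ ((y ⇒ x) ⇒ x)) ≡ ((y ⇒ x) ⇒ ((x ⇒ y) ⇒ y))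
  ⇒-mutual-comm x y = ax-antisym _ _ (mutual-swap x y) (mutual-swap y x)
    where
      mutual-swap : ∀ x y → ((x ⇒ y) ⇒ ((y ⇒ x) ⇒ x)) ≼ ((y ⇒ x) ⇒ ((x ⇒ y) ⇒ y))
      mutual-swap x y = valid ⊢y
        where
          ⊢y : ((x ⇒ y) ⇒ ((y ⇒ x) ⇒ x)) ∷ (y ⇒ x) ∷ (x ⇒ y) ∷ [] ⊢ y
          ⊢y = ⊢-mp (⊢-mp (⊢-hyp 2nd) (⊢-mp (⊢-hyp 3rd) (⊢-hyp 1st))) (⊢-hyp 3rd)

  ≤⇒≼ : ∀ {x y} → x ≤ y → x ≼ y
  ≤⇒≼ {x} x∨y≡y = subst (x ≼_) x∨y≡y (ax-∨₁ x _)

  ≼⇒≤ : ∀ {x y} → x ≼ y → x ≤ y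
  ≼⇒≤ {x} {y} x≼y = ax-antisym _ _ (modus-ponens x≼y (ax-∨₂ x y)) ∨-upperʳ
    where
      ∨-upperʳ : y ≼ (x ∨ y)
      ∨-upperʳ = subst (y ≼_) (∨-comm y x) (ax-∨₁ y x)

  ∨-monoʳ-≤ : ∀ x {y z} → y ≤ z → (x ∨ y) ≤ (x ∨ z)
  ∨-monoʳ-≤ x {y} {z} y≤z = begin
    (x ∨ y) ∨ (x ∨ z)   ≡⟨ ∨-assoc x y (x ∨ z) ⟩
    x ∨ (y ∨ (x ∨ z))   ≡⟨ cong (x ∨_) (sym (∨-assoc y x z)) ⟩
    x ∨ ((y ∨ x) ∨ z)   ≡⟨ cong (λ t → x ∨ (t ∨ z)) (∨-comm y x) ⟩
    x ∨ ((x ∨ y) ∨ z)   ≡⟨ cong (x ∨_) (∨-assoc x y z) ⟩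
    x ∨ (x ∨ (y ∨ z))   ≡⟨ cong (λ t → x ∨ (x ∨ t)) y≤z ⟩
    x ∨ (x ∨ z)         ≡⟨ sym (∨-assoc x x z) ⟩
    (x ∨ x) ∨ z         ≡⟨ cong (_∨ z) (∨-idem x) ⟩
    x ∨ z               ∎
    where open ≡-Reasoning

  ∨-least-≼ : ∀ x y z → (x ⇒ z) ≼ ((y ⇒ z) ⇒ ((x ∨ y) ⇒ z))
  ∨-least-≼ x y z = valid ⊢z
    where
      -- Pass through w ≥ y: then x ∨ y ≤ x ∨ w, and x ≼ w gives x ∨ w ≼ w by ax-∨₂.
      w : Carrier
      w = (y ⇒ z) ⇒ z
      Γ : List Carrier
      Γ = (x ⇒ z) ∷ (y ⇒ z) ∷ (x ∨ y) ∷ []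
      y≤w : y ≤ w
      y≤w = ≼⇒≤ (valid {y ∷ (y ⇒ z) ∷ []} (⊢-mp (⊢-hyp 1st) (⊢-hyp 2nd)))
      ⊢x⇒w : Γ ⊢ x ⇒ w
      ⊢x⇒w = ⊢-mp (⊢-const (ax-K z (y ⇒ z))) (⊢-≼ (⊢-hyp 1st) (⇒-trans-≼ x z w))
      ⊢x∨w : Γ ⊢ x ∨ w
      ⊢x∨w = ⊢-≼ (⊢-hyp 3rd) (≤⇒≼ (∨-monoʳ-≤ x y≤w))
      ⊢z : Γ ⊢ z
      ⊢z = ⊢-mp (⊢-hyp 2nd) (⊢-mp ⊢x∨w (⊢-≼ ⊢x⇒w (ax-∨₂ x w)))

  ∨-mono-≼ : ∀ x x' y y' → (x ⇒ x') ≼ ((y ⇒ y') ⇒ ((x ∨ y) ⇒ (x' ∨ y')))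
  ∨-mono-≼ x x' y y' = valid ⊢goal
    where
      Γ : List Carrier
      Γ = (x ⇒ x') ∷ (y ⇒ y') ∷ []
      ⊢x⇒x'∨y' : Γ ⊢ x ⇒ (x' ∨ y')
      ⊢x⇒x'∨y' = ⊢-mp (⊢-const (ax-∨₁ x' y')) (⊢-≼ (⊢-hyp 1st) (⇒-trans-≼ x x' _))
      ⊢y⇒x'∨y' : Γ ⊢ y ⇒ (x' ∨ y')
      ⊢y⇒x'∨y' = ⊢-mp (⊢-const (subst (y' ≼_) (∨-comm y' x') (ax-∨₁ y' x')))
                       (⊢-≼ (⊢-hyp 2nd) (⇒-trans-≼ y y' _))
      ⊢goal : Γ ⊢ (x ∨ y) ⇒ (x' ∨ y')
      ⊢goal = ⊢-mp ⊢y⇒x'∨y' (⊢-≼ ⊢x⇒x'∨y' (∨-least-≼ x y _))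

  △-𝟏 : △ 𝟏 ≡ 𝟏
  △-𝟏 = trans c≡c⇒△c (≼-S c≼c⇒△c (≼-refl c))
    where
      c : Carrier
      c = △ 𝟏
      c≡c⇒△c : c ≡ (c ⇒ △ c)
      c≡c⇒△c = begin
        c                                              ≡⟨ sym (ax-△₃ 𝟏 c) ⟩
        (c ⇒ △ c) ⇒ c                                  ≡⟨ cong₂ (λ s t → (s ⇒ t) ⇒ c)
                                                            (sym (⇒-identityˡ c)) (sym (⇒-identityˡ (△ c))) ⟩
        ((𝟏 ⇒ c) ⇒ (𝟏 ⇒ △ c)) ⇒ c                      ≡⟨ cong (λ t → ((𝟏 ⇒ c) ⇒ (𝟏 ⇒ △ c)) ⇒ △ t)
                                                            (sym (⇒-identityˡ 𝟏)) ⟩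
        ((𝟏 ⇒ c) ⇒ (𝟏 ⇒ △ c)) ⇒ △ (𝟏 ⇒ 𝟏)              ≡⟨ ax-△₂ 𝟏 𝟏 ⟩
        c ⇒ △ c                                        ∎
        where open ≡-Reasoning
      c≼c⇒△c : c ≼ (c ⇒ △ c)
      c≼c⇒△c = subst (c ≼_) c≡c⇒△c (≼-refl c)

  △-idem : ∀ x → △ (△ x) ≡ △ x
  △-idem x = ax-antisym _ _ (ax-△₁ (△ x)) △x≼△△x
    where
      P : Carrier
      P = (x ⇒ △ x) ⇒ (x ⇒ △ (△ x))
      △x≼△△x : △ x ≼ △ (△ x)
      △x≼△△x = begin
        △ x ⇒ △ (△ x)     ≡⟨ sym (ax-△₂ x x) ⟩
        P ⇒ △ (x ⇒ x)     ≡⟨ cong (λ t → P ⇒ △ t) (≼-refl x) ⟩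
        P ⇒ △ 𝟏           ≡⟨ cong (P ⇒_) △-𝟏 ⟩
        P ⇒ 𝟏             ≡⟨ ≼-top P ⟩
        𝟏                 ∎
        where open ≡-Reasoning

  △-distrib-≼ : ∀ x y → △ (x ⇒ y) ≼ (△ x ⇒ △ y)
  △-distrib-≼ x y = subst (△ (x ⇒ y) ≼_) (sym △x⇒△y≡P⇒△[x⇒y]) (ax-K (△ (x ⇒ y)) P)
    where
      P : Carrier
      P = (y ⇒ △ y) ⇒ (x ⇒ △ (△ x))
      △x⇒△y≡P⇒△[x⇒y] : (△ x ⇒ △ y) ≡ (P ⇒ △ (x ⇒ y))
      △x⇒△y≡P⇒△[x⇒y] = trans (cong (△ x ⇒_) (sym (△-idem y))) (sym (ax-△₂ x y))

  module CongruenceProperties {ℓ} {θ : Rel Carrier ℓ} (isCon : IsCongruence A θ) where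
    open IsCongruence isCon
    open IsEquivalence isEquivalence
      using () renaming (refl to ∼-refl; sym to ∼-sym; trans to ∼-trans)

    ⇒-𝟏ˡ : ∀ {x y} → θ x 𝟏 → θ (x ⇒ y) y
    ⇒-𝟏ˡ {y = y} x∼𝟏 = subst (θ _) (⇒-identityˡ y) (⇒-compat x∼𝟏 ∼-refl)

    ⇒-related-𝟏 : ∀ {x y} → θ x y → θ (x ⇒ y) 𝟏 × θ (y ⇒ x) 𝟏
    ⇒-related-𝟏 {x} {y} x∼y =
      subst (θ _) (≼-refl y) (⇒-compat x∼y ∼-refl) ,
      subst (θ _) (≼-refl x) (⇒-compat (∼-sym x∼y) ∼-refl)

    related-if-⇒-related-𝟏 : ∀ {x y} → θ (x ⇒ y) 𝟏 × θ (y ⇒ x) 𝟏 → θ x y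
    related-if-⇒-related-𝟏 {x} {y} (x⇒y∼𝟏 , y⇒x∼𝟏) =
      ∼-trans (∼-sym mutual-xy∼x) (subst (λ t → θ t y) (⇒-mutual-comm y x) mutual-yx∼y)
      where
        mutual-xy∼x : θ ((x ⇒ y) ⇒ ((y ⇒ x) ⇒ x)) x
        mutual-xy∼x = ∼-trans (⇒-𝟏ˡ x⇒y∼𝟏) (⇒-𝟏ˡ y⇒x∼𝟏)
        mutual-yx∼y : θ ((y ⇒ x) ⇒ ((x ⇒ y) ⇒ y)) y
        mutual-yx∼y = ∼-trans (⇒-𝟏ˡ y⇒x∼𝟏) (⇒-𝟏ˡ x⇒y∼𝟏)

    class-of-𝟏-isModalDS : IsModalDS A (λ x → θ x 𝟏)
    class-of-𝟏-isModalDS = record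
      { one-∈ = ∼-refl
      ; mp    = λ x∼𝟏 x⇒y∼𝟏 → ∼-trans (∼-sym (⇒-𝟏ˡ x∼𝟏)) x⇒y∼𝟏
      ; △-∈   = λ x∼𝟏 → subst (θ _) △-𝟏 (△-compat x∼𝟏)
      }

  Con→MDS : ∀ {ℓ} → Con A ℓ → MDS A ℓ
  Con→MDS (θ , isCon) = (λ x → θ x 𝟏) , class-of-𝟏-isModalDS
    where open CongruenceProperties isCon

  module ModalDSProperties {ℓ} {D : Pred Carrier ℓ} (isMDS : IsModalDS A D) where
    open IsModalDS isMDS

    ≡𝟏⇒∈ : ∀ {x} → x ≡ 𝟏 → x ∈ D
    ≡𝟏⇒∈ refl = one-∈

    mp₂ : ∀ {x y z} → x ≼ (y ⇒ z) → x ∈ D → y ∈ D → z ∈ D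
    mp₂ x≼y⇒z x∈D y∈D = mp y∈D (mp x∈D (≡𝟏⇒∈ x≼y⇒z))

    _~_ : Rel Carrier ℓ
    x ~ y = (x ⇒ y) ∈ D × (y ⇒ x) ∈ D

    ~-isCongruence : IsCongruence A _~_
    ~-isCongruence = record
      { isEquivalence = record
          { refl  = λ {x} → ≡𝟏⇒∈ (≼-refl x) , ≡𝟏⇒∈ (≼-refl x)
          ; sym   = λ (p , q) → q , p
          ; trans = λ {x} {y} {z} (p , q) (p' , q') →
              mp₂ (⇒-trans-≼ x y z) p p' , mp₂ (⇒-trans-≼ z y x) q' q
          }
      ; ⇒-compat = λ {x} {x'} {y} {y'} (p , q) (p' , q') →
          mp₂ (⇒-mono-≼ x x' y y') q p' , mp₂ (⇒-mono-≼ x' x y' y) p q'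
      ; ∨-compat = λ {x} {x'} {y} {y'} (p , q) (p' , q') →
          mp₂ (∨-mono-≼ x x' y y') p p' , mp₂ (∨-mono-≼ x' x y' y) q q'
      ; △-compat = λ {x} {x'} (p , q) →
          mp (△-∈ p) (≡𝟏⇒∈ (△-distrib-≼ x x')) , mp (△-∈ q) (≡𝟏⇒∈ (△-distrib-≼ x' x))
      }

    ~𝟏⇒∈ : ∀ {x} → x ~ 𝟏 → x ∈ D
    ~𝟏⇒∈ {x} (_ , 𝟏⇒x∈D) = subst D (⇒-identityˡ x) 𝟏⇒x∈D

    ∈⇒~𝟏 : ∀ {x} → x ∈ D → x ~ 𝟏
    ∈⇒~𝟏 {x} x∈D = ≡𝟏⇒∈ (≼-top x) , subst D (sym (⇒-identityˡ x)) x∈D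

  MDS→Con : ∀ {ℓ} → MDS A ℓ → Con A ℓ
  MDS→Con (D , isMDS) = _~_ , ~-isCongruence
    where open ModalDSProperties isMDS

mainTheorem16 : {a ℓ : Level} (A : H∨△₃ a) →
    OrderIso (Con A ℓ) (MDS A ℓ) (_⊆Con_ A) (_⊆MDS_ A)
mainTheorem16 A = record
  { to        = Con→MDS A
  ; from      = MDS→Con A
  ; to-mono   = λ θ⊆ψ → θ⊆ψ
  ; from-mono = λ D⊆E (p , q) → D⊆E p , D⊆E q
  ; from∘to₁  = λ (_ , isCon) → CongruenceProperties.related-if-⇒-related-𝟏 A isCon
  ; from∘to₂  = λ (_ , isCon) → CongruenceProperties.⇒-related-𝟏 A isCon
  ; to∘from₁  = λ (_ , isMDS) → ModalDSProperties.~𝟏⇒∈ A isMDS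
  ; to∘from₂  = λ (_ , isMDS) → ModalDSProperties.∈⇒~𝟏 A isMDS
  }
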